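{- Let $\mathbf B$ be a finite MTL-chain and $(W,P,e)$ a $\mathbf B$-preference model. For formulas $\varphi,\psi$ put $[\varphi\le_{\forall\exists}\psi]:=\bigwedge_{v\in W}\big(e(v,\varphi)\to e(v,\Diamond\psi)\big)$ and $[\varphi<_{\forall\exists}\psi]:=\bigwedge_{v\in W}\big(e(v,\varphi)\to e(v,\Diamond^<\psi)\big)$. Then for all formulas $\varphi,\psi,\chi$: (i) $[\varphi\le_{\forall\exists}\varphi]=1$ and $[\varphi\le_{\forall\exists}\psi]\odot[\psi\le_{\forall\exists}\chi]\le[\varphi\le_{\forall\exists}\chi]$; (ii) $[\varphi<_{\forall\exists}\psi]\odot[\psi<_{\forall\exists}\chi]\le[\varphi<_{\forall\exists}\chi]$.
   Context: A finite MTL-chain is a finite linearly ordered bounded integral commutative residuated lattice $\mathbf B=(B,\wedge,\vee,\odot,\to,0,1)$. A $\mathbf B$-preference model is $(W,P,e)$ with $W\ne\emptyset$, $P:W\times W\to B$ reflexive ($P(u,u)=1$) and $\wedge$-transitive ($P(u,v)\wedge P(v,w)\le P(u,w)$), $e$ a valuation of variables in $B$ at each world, extended to formulas with propositional connectives computed in $\mathbf B$, truth constants interpreted as themselves, and $e(v,\Diamond\varphi)=\bigvee_{w\in W}(P(v,w)\odot e(w,\varphi))$, $e(v,\Diamond^<\varphi)=\bigvee_{w\in W}(P^<(v,w)\odot e(w,\varphi))$, where $P^<(v,w)=P(v,w)$ if $P(v,w)>P(w,v)$ and $0$ otherwise. (In the paper, $[\varphi\le_{\forall\exists}\psi]$ is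 the value of the formula $\mathsf A(\varphi\to\Diamond\psi)$ with $\mathsf A$ the universal modality; the statements say that $\mathsf A(\varphi\to\Diamond\varphi)$ and $\mathsf A(\varphi\to\Diamond\psi)\to(\mathsf A(\psi\to\Diamond\chi)\to\mathsf A(\varphi\to\Diamond\chi))$, and its strict analogue, are valid.) -}

module Defs where

open import Data.Nat using (ℕ)
open import Data.Product using (_×_; Σ)
open import Data.List using (List)
open import Data.List.Membership.Propositional using (_∈_)
open import Relation.Binary.PropositionalEquality using (_≡_)
open import Relation.Binary.Structures using (IsTotalOrder)
open import Relation.Nullary using (¬_)
open import Data.Unit using (⊤)

record MTLChain : Set₁ where
  infixr 6 _⊓_ _⊔_
  infixr 7 _⊙_
  infixr 5 _⇒_
  infix 4 _≤_
  field
    Carrier : Set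
    _≤_     : Carrier → Carrier → Set
    isTotalOrder : IsTotalOrder _≡_ _≤_
    elements : List Carrier
    complete : ∀ x → x ∈ elements
    _⊓_ _⊔_ : Carrier → Carrier → Carrier
    ⊓-lb₁ : ∀ x y → x ⊓ y ≤ x
    ⊓-lb₂ : ∀ x y → x ⊓ y ≤ y
    ⊓-glb : ∀ x y z → z ≤ x → z ≤ y → z ≤ x ⊓ y
    ⊔-ub₁ : ∀ x y → x ≤ x ⊔ y
    ⊔-ub₂ : ∀ x y → y ≤ x ⊔ y
    ⊔-lub : ∀ x y z → x ≤ z → y ≤ z → x ⊔ y ≤ z
    𝟎 𝟏 : Carrier
    𝟎-least : ∀ x → 𝟎 ≤ x
    𝟏-greatest : ∀ x → x ≤ 𝟏
    _⊙_ : Carrier → Carrier → Carrier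
    ⊙-assoc : ∀ x y z → (x ⊙ y) ⊙ z ≡ x ⊙ (y ⊙ z)
    ⊙-comm  : ∀ x y → x ⊙ y ≡ y ⊙ x
    ⊙-identityʳ : ∀ x → x ⊙ 𝟏 ≡ x
    _⇒_ : Carrier → Carrier → Carrier
    residuation₁ : ∀ x y z → x ⊙ y ≤ z → x ≤ y ⇒ z
    residuation₂ : ∀ x y z → x ≤ y ⇒ z → x ⊙ y ≤ z

data Fm (C : Set) : Set where
  var  : ℕ → Fm C
  cst  : C → Fm C
  _∧ᶠ_ _∨ᶠ_ _⊙ᶠ_ _→ᶠ_ : Fm C → Fm C → Fm C
  ◇ ◇< : Fm C → Fm C

module _ (B : MTLChain) where
  open MTLChain B

  _<_ : Carrier → Carrier → Set
  x < y = x ≤ y × ¬ (x ≡ y)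

  -- s is the supremum of { f w | w ∈ W, S w }  (sup of ∅ is then 0)
  IsSupOver : {W : Set} → (W → Set) → (W → Carrier) → Carrier → Set
  IsSupOver {W} S f s =
    (∀ w → S w → f w ≤ s) × (∀ u → (∀ w → S w → f w ≤ u) → s ≤ u)

  IsInfOver : {W : Set} → (W → Carrier) → Carrier → Set
  IsInfOver {W} f s =
    (∀ w → s ≤ f w) × (∀ u → (∀ w → u ≤ f w) → u ≤ s)

  record PrefModel : Set₁ where
    field
      W      : Set
      w₀     : W
      P      : W → W → Carrier
      P-refl : ∀ u → P u u ≡ 𝟏
      P-trans : ∀ u v w → P u v ⊓ P v w ≤ P u w
      val    : W → ℕ → Carrier

  -- The clause for ◇< takes the sup over those w with P v w > P w v, i.e. over
  -- P<(v,w) ⊙ e(w,φ), the remaining terms being 0 ⊙ _ = 0.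
  record IsEvaluation (M : PrefModel) (ev : PrefModel.W M → Fm Carrier → Carrier) : Set where
    open PrefModel M
    field
      ev-var : ∀ v n → ev v (var n) ≡ val v n
      ev-cst : ∀ v c → ev v (cst c) ≡ c
      ev-∧   : ∀ v φ ψ → ev v (φ ∧ᶠ ψ) ≡ ev v φ ⊓ ev v ψ
      ev-∨   : ∀ v φ ψ → ev v (φ ∨ᶠ ψ) ≡ ev v φ ⊔ ev v ψ
      ev-⊙   : ∀ v φ ψ → ev v (φ ⊙ᶠ ψ) ≡ ev v φ ⊙ ev v ψ
      ev-→   : ∀ v φ ψ → ev v (φ →ᶠ ψ) ≡ ev v φ ⇒ ev v ψ
      ev-◇   : ∀ v φ → IsSupOver (λ _ → ⊤) (λ w → P v w ⊙ ev w φ) (ev v (◇ φ))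
      ev-◇<  : ∀ v φ → IsSupOver (λ w → P w v < P v w) (λ w → P v w ⊙ ev w φ) (ev v (◇< φ))

  Is≤∀∃ : (M : PrefModel) → (PrefModel.W M → Fm Carrier → Carrier) →
          Fm Carrier → Fm Carrier → Carrier → Set
  Is≤∀∃ M ev φ ψ x = IsInfOver (λ v → ev v φ ⇒ ev v (◇ ψ)) x

  Is<∀∃ : (M : PrefModel) → (PrefModel.W M → Fm Carrier → Carrier) →
          Fm Carrier → Fm Carrier → Carrier → Set
  Is<∀∃ M ev φ ψ x = IsInfOver (λ v → ev v φ ⇒ ev v (◇< ψ)) x

module Submission where

-- Both ◇ and ◇< are instances of one construction: for a relation S on
-- worlds, a "diamond along S" of f : W → B assigns to v the supremum of
-- P(v,w) ⊙ f(w) over the w with S v w (S total for ◇; S v w iff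
-- P(w,v) < P(v,w) for ◇<).  Whenever S is transitive, ⊙-transitivity of P
-- shows that diamonds can be pulled back along S-steps, and hence that
-- pointwise bounds b ⊙ g ≤ ◇h lift to b ⊙ ◇g ≤ ◇h.  Since [φ ≤∀∃ ψ] is the
-- infimum of e(v,φ) → e(v,◇ψ), residuation turns this into the
-- transitivity law; reflexivity of S together with P(v,v) = 1 gives
-- [φ ≤∀∃ φ] = 1.  The file first collects arithmetic of MTL-chains, then
-- facts about preference models (⊙-transitivity of P, transitivity of the
-- strict part), then the general diamond lemmas, and finally derives
-- Lemma 8 by instantiating them with S total and with S the strict part.

open import Defs
open import Data.Product using (_×_; _,_; proj₁)
open import Data.Sum using (inj₁; inj₂)
open import Data.Empty using (⊥; ⊥-elim)
open import Data.Unit using (⊤; tt)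
open import Relation.Binary.PropositionalEquality
  using (_≡_; sym; cong; cong₂; isEquivalence)
open import Relation.Binary.Structures using (IsTotalOrder)
open import Relation.Binary.Bundles using (TotalOrder)
open import Algebra.Bundles using (CommutativeSemigroup)
import Algebra.Properties.CommutativeSemigroup as CommSemigroupProperties
import Relation.Binary.Reasoning.PartialOrder as PartialOrderReasoning

module ChainFacts (B : MTLChain) where
  open MTLChain B
  open IsTotalOrder isTotalOrder public
    using (antisym; total)
    renaming (refl to ≤-refl; reflexive to ≤-reflexive; trans to ≤-trans)

  totalOrder : TotalOrder _ _ _
  totalOrder = record { isTotalOrder = isTotalOrder }

  open PartialOrderReasoning (TotalOrder.poset totalOrder) public

  -- (B, ⊙) as a commutative semigroup, to reuse the library's rearrangements.
  ⊙-commutativeSemigroup : CommutativeSemigroup _ _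
  ⊙-commutativeSemigroup = record
    { isCommutativeSemigroup = record
      { isSemigroup = record
        { isMagma = record { isEquivalence = isEquivalence ; ∙-cong = cong₂ _⊙_ }
        ; assoc = ⊙-assoc }
      ; comm = ⊙-comm } }

  open CommSemigroupProperties ⊙-commutativeSemigroup public
    using (xy∙z≈y∙xz; xy∙z≈zy∙x; xy∙z≈zx∙y)

  ⊙-identityˡ : ∀ x → 𝟏 ⊙ x ≡ x
  ⊙-identityˡ x = begin-equality
    𝟏 ⊙ x  ≡⟨ ⊙-comm 𝟏 x ⟩
    x ⊙ 𝟏  ≡⟨ ⊙-identityʳ x ⟩
    x      ∎

  -- Monotonicity of ⊙ follows from residuation alone.
  ⊙-monoˡ : ∀ {x y} z → x ≤ y → x ⊙ z ≤ y ⊙ z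
  ⊙-monoˡ {x} {y} z x≤y =
    residuation₂ x z (y ⊙ z) (≤-trans x≤y (residuation₁ y z (y ⊙ z) ≤-refl))

  ⊙-monoʳ : ∀ {x y} z → x ≤ y → z ⊙ x ≤ z ⊙ y
  ⊙-monoʳ {x} {y} z x≤y = begin
    z ⊙ x  ≡⟨ ⊙-comm z x ⟩
    x ⊙ z  ≤⟨ ⊙-monoˡ z x≤y ⟩
    y ⊙ z  ≡⟨ ⊙-comm y z ⟩
    z ⊙ y  ∎

  ⊙-decreasingˡ : ∀ x y → x ⊙ y ≤ x
  ⊙-decreasingˡ x y = begin
    x ⊙ y  ≤⟨ ⊙-monoʳ x (𝟏-greatest y) ⟩
    x ⊙ 𝟏  ≡⟨ ⊙-identityʳ x ⟩
    x      ∎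

  ⊙≤⊓ : ∀ x y → x ⊙ y ≤ x ⊓ y
  ⊙≤⊓ x y = ⊓-glb x y (x ⊙ y) (⊙-decreasingˡ x y) (begin
    x ⊙ y  ≡⟨ ⊙-comm x y ⟩
    y ⊙ x  ≤⟨ ⊙-decreasingˡ y x ⟩
    y      ∎)

  -- ⊙ b distributes over suprema (it is a left adjoint): to bound s ⊙ b it
  -- suffices to bound every f w ⊙ b.
  sup-⊙-≤ : ∀ {W : Set} {S : W → Set} {f : W → Carrier} {s} b t →
            IsSupOver B S f s → (∀ w → S w → f w ⊙ b ≤ t) → s ⊙ b ≤ t
  sup-⊙-≤ {s = s} b t (_ , least) bound =
    residuation₂ s b t (least (b ⇒ t) (λ w Sw → residuation₁ _ b t (bound w Sw)))

  inf-⇒-elim : ∀ {W : Set} {f g : W → Carrier} {a} →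
               IsInfOver B (λ v → f v ⇒ g v) a → ∀ v → a ⊙ f v ≤ g v
  inf-⇒-elim {f = f} {g} {a} (lower , _) v = residuation₂ a (f v) (g v) (lower v)

  inf-⇒-intro : ∀ {W : Set} {f g : W → Carrier} {a} x →
                IsInfOver B (λ v → f v ⇒ g v) a → (∀ v → x ⊙ f v ≤ g v) → x ≤ a
  inf-⇒-intro {f = f} {g} x (_ , greatest) bound =
    greatest x (λ v → residuation₁ x (f v) (g v) (bound v))

module PreferenceFacts (B : MTLChain) (M : PrefModel B) where
  open MTLChain B
  open PrefModel M
  open ChainFacts B

  P-⊙-trans : ∀ v w u → P v w ⊙ P w u ≤ P v u
  P-⊙-trans v w u = ≤-trans (⊙≤⊓ (P v w) (P w u)) (P-trans v w u)

  -- v ≺ w: the pair (v, w) lies in the strict part of P, i.e. P<(v,w) = P(v,w).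
  _≺_ : W → W → Set
  v ≺ w = _<_ B (P w v) (P v w)

  P-trans-below : ∀ {v w u x} → x ≤ P v w → x ≤ P w u → x ≤ P v u
  P-trans-below {v} {w} {u} x≤vw x≤wu = ≤-trans (⊓-glb _ _ _ x≤vw x≤wu) (P-trans v w u)

  -- The key
  -- case: v ≺ w, w ≺ u and P(v,u) ≤ P(u,v) are incompatible, because then
  -- min(P(v,w), P(w,u)) ≤ P(u,v) and closing the cycle through u reverses
  -- whichever of the two strict steps carries the minimum.
  ≺-not-reversed : ∀ {v w u} → v ≺ w → w ≺ u → P v u ≤ P u v → ⊥
  ≺-not-reversed {v} {w} {u} (wv≤vw , wv≢vw) (uw≤wu , uw≢wu) vu≤uv
    with total (P v w) (P w u)
  ... | inj₁ vw≤wu = wv≢vw (antisym wv≤vw (begin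
    P v w          ≤⟨ ⊓-glb _ _ _ vw≤wu (≤-trans (P-trans-below ≤-refl vw≤wu) vu≤uv) ⟩
    P w u ⊓ P u v  ≤⟨ P-trans w u v ⟩
    P w v          ∎))
  ... | inj₂ wu≤vw = uw≢wu (antisym uw≤wu (begin
    P w u          ≤⟨ ⊓-glb _ _ _ (≤-trans (P-trans-below wu≤vw ≤-refl) vu≤uv) wu≤vw ⟩
    P u v ⊓ P v w  ≤⟨ P-trans u v w ⟩
    P u w          ∎))

  ≺-trans : ∀ {v w u} → v ≺ w → w ≺ u → v ≺ u
  ≺-trans {v} {w} {u} v≺w w≺u with total (P u v) (P v u)
  ... | inj₁ uv≤vu = uv≤vu , λ uv≡vu → ≺-not-reversed v≺w w≺u (≤-reflexive (sym uv≡vu))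
  ... | inj₂ vu≤uv = ⊥-elim (≺-not-reversed v≺w w≺u vu≤uv)

module Diamond (B : MTLChain) (M : PrefModel B)
               (S : PrefModel.W M → PrefModel.W M → Set)
               (S-trans : ∀ {v w u} → S v w → S w u → S v u) where
  open MTLChain B
  open PrefModel M
  open ChainFacts B
  open PreferenceFacts B M using (P-⊙-trans)

  IsDiamond : (W → Carrier) → (W → Carrier) → Set
  IsDiamond f d = ∀ v → IsSupOver B (S v) (λ w → P v w ⊙ f w) (d v)

  diamond-pullback : ∀ {f d} → IsDiamond f d → ∀ {v w} → S v w → d w ⊙ P v w ≤ d v
  diamond-pullback {f} {d} isD {v} {w} Svw = sup-⊙-≤ (P v w) (d v) (isD w) λ u Swu → begin
    (P w u ⊙ f u) ⊙ P v w  ≡⟨ xy∙z≈zx∙y (P w u) (f u) (P v w) ⟩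
    (P v w ⊙ P w u) ⊙ f u  ≤⟨ ⊙-monoˡ (f u) (P-⊙-trans v w u) ⟩
    P v u ⊙ f u            ≤⟨ proj₁ (isD v) u (S-trans Svw Swu) ⟩
    d v                    ∎

  diamond-lift : ∀ {g dg h dh} b → IsDiamond g dg → IsDiamond h dh →
                 (∀ w → b ⊙ g w ≤ dh w) → ∀ v → b ⊙ dg v ≤ dh v
  diamond-lift {g = g} {dg = dg} {dh = dh} b isDg isDh bound v = begin
    b ⊙ dg v  ≡⟨ ⊙-comm b (dg v) ⟩
    dg v ⊙ b  ≤⟨ sup-⊙-≤ b (dh v) (isDg v) step ⟩
    dh v      ∎
    where
    step : ∀ w → S v w → (P v w ⊙ g w) ⊙ b ≤ dh v
    step w Svw = begin
      (P v w ⊙ g w) ⊙ b  ≡⟨ xy∙z≈zy∙x (P v w) (g w) b ⟩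
      (b ⊙ g w) ⊙ P v w  ≤⟨ ⊙-monoˡ (P v w) (bound w) ⟩
      dh w ⊙ P v w       ≤⟨ diamond-pullback isDh Svw ⟩
      dh v               ∎

  Is∀∃ : (W → Carrier) → (W → Carrier) → Carrier → Set
  Is∀∃ f dg a = IsInfOver B (λ v → f v ⇒ dg v) a

  ∀∃-trans : ∀ {f g dg h dh a b c} → IsDiamond g dg → IsDiamond h dh →
             Is∀∃ f dg a → Is∀∃ g dh b → Is∀∃ f dh c → a ⊙ b ≤ c
  ∀∃-trans {f = f} {dg = dg} {dh = dh} {a = a} {b = b} isDg isDh f≤g g≤h f≤h =
    inf-⇒-intro (a ⊙ b) f≤h λ v → begin
      (a ⊙ b) ⊙ f v  ≡⟨ xy∙z≈y∙xz a b (f v) ⟩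
      b ⊙ (a ⊙ f v)  ≤⟨ ⊙-monoʳ b (inf-⇒-elim f≤g v) ⟩
      b ⊙ dg v       ≤⟨ diamond-lift b isDg isDh (inf-⇒-elim g≤h) v ⟩
      dh v           ∎

  ∀∃-refl : (∀ v → S v v) → ∀ {f d a} → IsDiamond f d → Is∀∃ f d a → a ≡ 𝟏
  ∀∃-refl S-refl {f} {d} isD f≤f =
    antisym (𝟏-greatest _) (inf-⇒-intro 𝟏 f≤f λ v → begin
      𝟏 ⊙ f v      ≡⟨ cong (_⊙ f v) (P-refl v) ⟨
      P v v ⊙ f v  ≤⟨ proj₁ (isD v) v (S-refl v) ⟩
      d v          ∎)

lemma8 : (B : MTLChain) (M : PrefModel B)
         (ev : PrefModel.W M → Fm (MTLChain.Carrier B) → MTLChain.Carrier B) →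
         IsEvaluation B M ev →
         ∀ (φ ψ χ : Fm (MTLChain.Carrier B)) →
         (∀ a → Is≤∀∃ B M ev φ φ a → a ≡ MTLChain.𝟏 B)
         × (∀ a b c → Is≤∀∃ B M ev φ ψ a → Is≤∀∃ B M ev ψ χ b → Is≤∀∃ B M ev φ χ c →
              MTLChain._≤_ B (MTLChain._⊙_ B a b) c)
         × (∀ a b c → Is<∀∃ B M ev φ ψ a → Is<∀∃ B M ev ψ χ b → Is<∀∃ B M ev φ χ c →
              MTLChain._≤_ B (MTLChain._⊙_ B a b) c)
lemma8 B M ev E φ ψ χ =
    (λ _ → ◇.∀∃-refl (λ _ → tt) (λ v → ev-◇ v φ))
  , (λ _ _ _ → ◇.∀∃-trans (λ v → ev-◇ v ψ) (λ v → ev-◇ v χ))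
  , (λ _ _ _ → ◇<.∀∃-trans (λ v → ev-◇< v ψ) (λ v → ev-◇< v χ))
  where
  open IsEvaluation E
  open PreferenceFacts B M using (_≺_; ≺-trans)
  module ◇  = Diamond B M (λ _ _ → ⊤) (λ _ _ → tt)
  module ◇< = Diamond B M _≺_ ≺-trans
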